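{- For every $k \in \mathbb{N}$, let $F_k$ be the graph obtained from $k$ disjoint copies of the cycle $C_4$ by choosing one vertex from each copy and identifying all chosen vertices into a single vertex $x$, and then attaching a path of length 2 at $x$ (i.e. adding new vertices $a,b$ and edges $xa$, $ab$). Then $F_k$ is connected and $(P_6,C_6)$-free, and $\gamma_c(F_k) = \gamma(F_k) + 1$.
   Context: $\gamma(G)$ is the minimum size of a dominating set of $G$ (a set $X$ such that every vertex outside $X$ has a neighbor in $X$); $\gamma_c(G)$ is the minimum size of a dominating set inducing a connected subgraph. $P_k$, $C_k$ denote the path and cycle on $k$ vertices; $(P_6,C_6)$-free means no induced $P_6$ and no induced $C_6$. -}

module Defs where

open import Level using (0ℓ)
open import Data.Nat using (ℕ; zero; suc; _≤_; _∸_)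
open import Data.Fin using (Fin; toℕ; zero; suc)
open import Data.List using (List; length)
open import Data.List.Membership.Propositional using (_∈_)
open import Data.List.Relation.Unary.Unique.Propositional using (Unique)
open import Data.Product using (Σ; ∃; _×_; _,_)
open import Data.Sum using (_⊎_; inj₁; inj₂)
open import Data.Empty using (⊥)
open import Data.Unit using (⊤)
open import Relation.Binary.PropositionalEquality using (_≡_)
open import Function using (Injective)
open import Function.Bundles using (_⇔_)

record Graph : Set₁ where
  field
    V     : Set
    _~_   : V → V → Set
    sym~  : ∀ {u v} → u ~ v → v ~ u
    irr~  : ∀ {u} → u ~ u → ⊥
open Graph public
  hiding (_~_)

Adj : (G : Graph) → V G → V G → Set
Adj G = Graph._~_ G

data WalkIn (G : Graph) (P : V G → Set) : V G → V G → Set where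
  here : ∀ {u} → P u → WalkIn G P u u
  step : ∀ {u w v} → P u → Adj G u w → WalkIn G P w v → WalkIn G P u v

Connected : Graph → Set
Connected G = ∀ (u v : V G) → WalkIn G (λ _ → ⊤) u v

-- vertex sets are duplicate-free lists; their size is the length
Dominating : (G : Graph) → List (V G) → Set
Dominating G S = ∀ (v : V G) → v ∈ S ⊎ Σ (V G) (λ u → u ∈ S × Adj G u v)

InducesConnected : (G : Graph) → List (V G) → Set
InducesConnected G S = ∀ {u v} → u ∈ S → v ∈ S → WalkIn G (λ w → w ∈ S) u v

ConnDominating : (G : Graph) → List (V G) → Set
ConnDominating G S = Dominating G S × InducesConnected G S

IsDomNumber : (G : Graph) → ℕ → Set
IsDomNumber G m =
  Σ (List (V G)) (λ S → Unique S × Dominating G S × length S ≡ m)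
  × (∀ (S : List (V G)) → Unique S → Dominating G S → m ≤ length S)

IsConnDomNumber : (G : Graph) → ℕ → Set
IsConnDomNumber G m =
  Σ (List (V G)) (λ S → Unique S × ConnDominating G S × length S ≡ m)
  × (∀ (S : List (V G)) → Unique S → ConnDominating G S → m ≤ length S)

PathAdj : ∀ {n} → Fin n → Fin n → Set
PathAdj i j = suc (toℕ i) ≡ toℕ j ⊎ suc (toℕ j) ≡ toℕ i

CycleAdj : ∀ {n} → Fin n → Fin n → Set
CycleAdj {n} i j = PathAdj i j
  ⊎ (toℕ i ≡ 0 × toℕ j ≡ n ∸ 1)
  ⊎ (toℕ j ≡ 0 × toℕ i ≡ n ∸ 1)

HasInduced : (G : Graph) (n : ℕ) → (Fin n → Fin n → Set) → Set
HasInduced G n R = Σ (Fin n → V G) (λ f →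
  Injective _≡_ _≡_ f × (∀ i j → Adj G (f i) (f j) ⇔ R i j))

PFree : ℕ → Graph → Set
PFree n G = HasInduced G n PathAdj → ⊥

CFree : ℕ → Graph → Set
CFree n G = HasInduced G n CycleAdj → ⊥

data FV (k : ℕ) : Set where
  x a b : FV k
  c     : Fin k → Fin 3 → FV k   -- copy i of C_4 is x - c i 0 - c i 1 - c i 2 - x

data FE {k : ℕ} : FV k → FV k → Set where
  xa  : FE x a
  ab  : FE a b
  xc0 : ∀ i → FE x (c i zero)
  c01 : ∀ i → FE (c i zero) (c i (suc zero))
  c12 : ∀ i → FE (c i (suc zero)) (c i (suc (suc zero)))
  c2x : ∀ i → FE (c i (suc (suc zero))) x

FAdj : ∀ {k} → FV k → FV k → Set
FAdj u v = FE u v ⊎ FE v u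

private
  FE-irr : ∀ {k} {u : FV k} → FE u u → ⊥
  FE-irr ()

  FAdj-sym : ∀ {k} {u v : FV k} → FAdj u v → FAdj v u
  FAdj-sym (inj₁ e) = inj₂ e
  FAdj-sym (inj₂ e) = inj₁ e

  FAdj-irr : ∀ {k} {u : FV k} → FAdj u u → ⊥
  FAdj-irr (inj₁ e) = FE-irr e
  FAdj-irr (inj₂ e) = FE-irr e

F : ℕ → Graph
F k = record { V = FV k ; _~_ = FAdj ; sym~ = FAdj-sym ; irr~ = FAdj-irr }

-- Removing x leaves components with at most three vertices, so every induced P₄ of F k
-- has x as an inner vertex.  An induced P₆ or C₆ contains two induced P₄'s with
-- disjoint interiors, hence would contain x twice.
--
-- A dominating set must contain a or b (to dominate b) and a vertex of each C₄ copy
-- (to dominate its vertex opposite x), which gives γ ≥ k + 1, attained by a together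
-- with the vertices opposite x.  If it is moreover connected, the walk from a or b to a
-- copy runs through x, so γ_c ≥ k + 2, attained by x, a and a neighbour of x in each copy.
module Submission where

open import Defs
open import Data.Nat using (ℕ; suc; _≤_; z≤n; s≤s)
open import Data.Product using (Σ; ∃; _×_; _,_; proj₁; proj₂)
open import Data.Sum using (_⊎_; inj₁; inj₂)
open import Data.Empty using (⊥; ⊥-elim)
open import Data.Unit using (⊤; tt)
open import Data.Fin using (Fin; zero; suc; fromℕ<; #_)
open import Data.List using (List; []; _∷_; length; tabulate)
open import Data.List.Properties using (length-tabulate)
open import Data.List.Relation.Unary.Any using (here; there)
open import Data.List.Relation.Unary.All as All using (_∷_)
open import Data.List.Relation.Unary.AllPairs using (_∷_)
open import Data.List.Membership.Propositional using (_∈_)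
open import Data.List.Membership.Propositional.Properties using (∈-tabulate⁺; ∈-tabulate⁻)
open import Data.List.Relation.Binary.Subset.Propositional using (_⊆_)
open import Data.List.Relation.Unary.Unique.Propositional using (Unique)
import Data.List.Relation.Unary.Unique.Propositional.Properties as Unique
open import Relation.Nullary using (¬_)
open import Relation.Binary.PropositionalEquality using (_≡_; _≢_; refl; sym; trans; cong; subst)
open import Function.Bundles using (Equivalence; _⇔_)

module _ {G : Graph} {P : V G → Set} where

  _++ʷ_ : ∀ {u v w} → WalkIn G P u v → WalkIn G P v w → WalkIn G P u w
  here _       ++ʷ q = q
  step p e r   ++ʷ q = step p e (r ++ʷ q)

  walk-head : ∀ {u v} → WalkIn G P u v → P u
  walk-head (here p)     = p
  walk-head (step p _ _) = p

  walk-reverse : ∀ {u v} → WalkIn G P u v → WalkIn G P v u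
  walk-reverse (here p)     = here p
  walk-reverse (step p e r) = walk-reverse r ++ʷ step (walk-head r) (sym~ G e) (here p)

  walk-via : ∀ {z} → (∀ {u} → P u → WalkIn G P u z) →
             ∀ {u v} → P u → P v → WalkIn G P u v
  walk-via to-z pu pv = to-z pu ++ʷ walk-reverse (to-z pv)

module _ {A : Set} where

  ∈-remove : ∀ {t : A} (S : List A) → t ∈ S →
             ∃ λ S′ → length S ≡ suc (length S′) × (∀ {u} → u ∈ S → u ≢ t → u ∈ S′)
  ∈-remove (s ∷ S) (here refl) = S , refl , λ { (here e) u≢t → ⊥-elim (u≢t e) ; (there m) _ → m }
  ∈-remove (s ∷ S) (there t∈S) with ∈-remove S t∈S
  ... | S′ , eq , keep = s ∷ S′ , cong suc eq ,
        λ { (here e) _ → here e ; (there m) u≢t → there (keep m u≢t) }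

  Unique-⊆⇒length≤ : ∀ {T S : List A} → Unique T → T ⊆ S → length T ≤ length S
  Unique-⊆⇒length≤ {[]}    _          _   = z≤n
  Unique-⊆⇒length≤ {t ∷ T} {S} (t∉T ∷ uT) T⊆S with ∈-remove S (T⊆S (here refl))
  ... | S′ , eq , keep = subst (suc (length T) ≤_) (sym eq)
        (s≤s (Unique-⊆⇒length≤ uT λ m → keep (T⊆S (there m)) λ e → All.lookup t∉T m (sym e)))

record InducedP₄ (G : Graph) (u₀ u₁ u₂ u₃ : V G) : Set where
  constructor inducedP₄
  field
    adj₀₁  : Adj G u₀ u₁
    adj₁₂  : Adj G u₁ u₂
    adj₂₃  : Adj G u₂ u₃
    u₀≢u₂  : u₀ ≢ u₂
    u₁≢u₃  : u₁ ≢ u₃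
    ¬adj₀₃ : ¬ Adj G u₀ u₃

InnerOfEveryP₄ : (G : Graph) → V G → Set
InnerOfEveryP₄ G z = ∀ {u₀ u₁ u₂ u₃} → InducedP₄ G u₀ u₁ u₂ u₃ → u₁ ≡ z ⊎ u₂ ≡ z

module InducedCopy (G : Graph) {n : ℕ} (R : Fin n → Fin n → Set) (emb : HasInduced G n R) where

  private
    f : Fin n → V G
    f = proj₁ emb

    f-inj : ∀ {i j} → f i ≡ f j → i ≡ j
    f-inj = proj₁ (proj₂ emb)

    f-iso : ∀ i j → Adj G (f i) (f j) ⇔ R i j
    f-iso = proj₂ (proj₂ emb)

  inducedP₄-of : ∀ i j k l → R i j → R j k → R k l → i ≢ k → j ≢ l → ¬ R i l →
                 InducedP₄ G (f i) (f j) (f k) (f l)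
  inducedP₄-of i j k l rij rjk rkl i≢k j≢l ¬ril = inducedP₄
    (Equivalence.from (f-iso i j) rij) (Equivalence.from (f-iso j k) rjk) (Equivalence.from (f-iso k l) rkl)
    (λ e → i≢k (f-inj e)) (λ e → j≢l (f-inj e)) (λ e → ¬ril (Equivalence.to (f-iso i l) e))

  private
    hits-once : ∀ {z i j} → f i ≡ z → f j ≡ z → i ≡ j
    hits-once fi≡z fj≡z = f-inj (trans fi≡z (sym fj≡z))

  disjoint-hits : ∀ {z} i j k l → i ≢ k → i ≢ l → j ≢ k → j ≢ l →
                  f i ≡ z ⊎ f j ≡ z → f k ≡ z ⊎ f l ≡ z → ⊥
  disjoint-hits _ _ _ _ i≢k _   _   _   (inj₁ p) (inj₁ q) = i≢k (hits-once p q)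
  disjoint-hits _ _ _ _ _   i≢l _   _   (inj₁ p) (inj₂ q) = i≢l (hits-once p q)
  disjoint-hits _ _ _ _ _   _   j≢k _   (inj₂ p) (inj₁ q) = j≢k (hits-once p q)
  disjoint-hits _ _ _ _ _   _   _   j≢l (inj₂ p) (inj₂ q) = j≢l (hits-once p q)

module _ {G : Graph} {z : V G} (inner : InnerOfEveryP₄ G z) where

  inner-of-every-P₄⇒P₆-free : PFree 6 G
  inner-of-every-P₄⇒P₆-free P₆ = disjoint-hits (# 1) (# 2) (# 3) (# 4) (λ ()) (λ ()) (λ ()) (λ ())
    (inner (inducedP₄-of (# 0) (# 1) (# 2) (# 3) (inj₁ refl) (inj₁ refl) (inj₁ refl) (λ ()) (λ ())
      λ { (inj₁ ()) ; (inj₂ ()) }))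
    (inner (inducedP₄-of (# 2) (# 3) (# 4) (# 5) (inj₁ refl) (inj₁ refl) (inj₁ refl) (λ ()) (λ ())
      λ { (inj₁ ()) ; (inj₂ ()) }))
    where open InducedCopy G PathAdj P₆

  inner-of-every-P₄⇒C₆-free : CFree 6 G
  inner-of-every-P₄⇒C₆-free C₆ = disjoint-hits (# 1) (# 2) (# 4) (# 5) (λ ()) (λ ()) (λ ()) (λ ())
    (inner (inducedP₄-of (# 0) (# 1) (# 2) (# 3) (inj₁ (inj₁ refl)) (inj₁ (inj₁ refl)) (inj₁ (inj₁ refl))
      (λ ()) (λ ()) λ { (inj₁ (inj₁ ())) ; (inj₁ (inj₂ ())) ; (inj₂ (inj₁ (_ , ()))) ; (inj₂ (inj₂ (() , _))) }))
    (inner (inducedP₄-of (# 3) (# 4) (# 5) (# 0) (inj₁ (inj₁ refl)) (inj₁ (inj₁ refl)) (inj₂ (inj₂ (refl , refl)))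
      (λ ()) (λ ()) λ { (inj₁ (inj₁ ())) ; (inj₁ (inj₂ ())) ; (inj₂ (inj₁ (() , _))) ; (inj₂ (inj₂ (_ , ()))) }))
    where open InducedCopy G CycleAdj C₆

module _ {k : ℕ} where

  x-inner-of-every-P₄ : InnerOfEveryP₄ (F k) x
  x-inner-of-every-P₄ (inducedP₄ _              (inj₁ xa)       _               _ _ _) = inj₁ refl
  x-inner-of-every-P₄ (inducedP₄ _              (inj₂ xa)       _               _ _ _) = inj₂ refl
  x-inner-of-every-P₄ (inducedP₄ _              (inj₁ (xc0 i))  _               _ _ _) = inj₁ refl
  x-inner-of-every-P₄ (inducedP₄ _              (inj₂ (xc0 i))  _               _ _ _) = inj₂ refl
  x-inner-of-every-P₄ (inducedP₄ _              (inj₁ (c2x i))  _               _ _ _) = inj₂ refl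
  x-inner-of-every-P₄ (inducedP₄ _              (inj₂ (c2x i))  _               _ _ _) = inj₁ refl
  x-inner-of-every-P₄ (inducedP₄ _              (inj₁ ab)       (inj₂ ab)       _ u₁≢u₃ _) = ⊥-elim (u₁≢u₃ refl)
  x-inner-of-every-P₄ (inducedP₄ (inj₁ ab)      (inj₂ ab)       _               u₀≢u₂ _ _) = ⊥-elim (u₀≢u₂ refl)
  x-inner-of-every-P₄ (inducedP₄ _              (inj₁ (c01 i))  (inj₂ (c01 i))  _ u₁≢u₃ _) = ⊥-elim (u₁≢u₃ refl)
  x-inner-of-every-P₄ (inducedP₄ (inj₂ (c01 i)) (inj₁ (c01 i))  _               u₀≢u₂ _ _) = ⊥-elim (u₀≢u₂ refl)
  x-inner-of-every-P₄ (inducedP₄ (inj₁ (xc0 i)) (inj₁ (c01 i))  (inj₁ (c12 i))  _ _ ¬adj) = ⊥-elim (¬adj (inj₂ (c2x i)))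
  x-inner-of-every-P₄ (inducedP₄ _              (inj₂ (c01 i))  (inj₁ (c01 i))  _ u₁≢u₃ _) = ⊥-elim (u₁≢u₃ refl)
  x-inner-of-every-P₄ (inducedP₄ (inj₁ (c01 i)) (inj₂ (c01 i))  _               u₀≢u₂ _ _) = ⊥-elim (u₀≢u₂ refl)
  x-inner-of-every-P₄ (inducedP₄ (inj₂ (c12 i)) (inj₂ (c01 i))  (inj₂ (xc0 i))  _ _ ¬adj) = ⊥-elim (¬adj (inj₁ (c2x i)))
  x-inner-of-every-P₄ (inducedP₄ _              (inj₁ (c12 i))  (inj₂ (c12 i))  _ u₁≢u₃ _) = ⊥-elim (u₁≢u₃ refl)
  x-inner-of-every-P₄ (inducedP₄ (inj₂ (c12 i)) (inj₁ (c12 i))  _               u₀≢u₂ _ _) = ⊥-elim (u₀≢u₂ refl)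
  x-inner-of-every-P₄ (inducedP₄ (inj₁ (c01 i)) (inj₁ (c12 i))  (inj₁ (c2x i))  _ _ ¬adj) = ⊥-elim (¬adj (inj₂ (xc0 i)))
  x-inner-of-every-P₄ (inducedP₄ _              (inj₂ (c12 i))  (inj₁ (c12 i))  _ u₁≢u₃ _) = ⊥-elim (u₁≢u₃ refl)
  x-inner-of-every-P₄ (inducedP₄ (inj₁ (c12 i)) (inj₂ (c12 i))  _               u₀≢u₂ _ _) = ⊥-elim (u₀≢u₂ refl)
  x-inner-of-every-P₄ (inducedP₄ (inj₂ (c2x i)) (inj₂ (c12 i))  (inj₂ (c01 i))  _ _ ¬adj) = ⊥-elim (¬adj (inj₁ (xc0 i)))

  walk-to-x : ∀ (u : FV k) → WalkIn (F k) (λ _ → ⊤) u x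
  walk-to-x x                      = here tt
  walk-to-x a                      = step tt (inj₂ xa) (here tt)
  walk-to-x b                      = step tt (inj₂ ab) (walk-to-x a)
  walk-to-x (c i zero)             = step tt (inj₂ (xc0 i)) (here tt)
  walk-to-x (c i (suc zero))       = step tt (inj₁ (c12 i)) (walk-to-x (c i (suc (suc zero))))
  walk-to-x (c i (suc (suc zero))) = step tt (inj₁ (c2x i)) (here tt)

  F-connected : Connected (F k)
  F-connected u v = walk-via (λ {w} _ → walk-to-x w) tt tt

  data OnTail : FV k → Set where
    tail-a : OnTail a
    tail-b : OnTail b

  data OnCycle : FV k → Set where
    on-cycle : ∀ i n → OnCycle (c i n)

  tail≢cycle : ∀ {u v} → OnTail u → OnCycle v → u ≢ v
  tail≢cycle tail-a (on-cycle _ _) ()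
  tail≢cycle tail-b (on-cycle _ _) ()

  x≢tail : ∀ {u} → OnTail u → x ≢ u
  x≢tail tail-a ()
  x≢tail tail-b ()

  x≢cycle : ∀ {u} → OnCycle u → x ≢ u
  x≢cycle (on-cycle _ _) ()

  walk-tail→cycle-visits-x : ∀ {P u v} → WalkIn (F k) P u v → OnTail u → OnCycle v → P x
  walk-tail→cycle-visits-x (here _)               tail-a ()
  walk-tail→cycle-visits-x (here _)               tail-b ()
  walk-tail→cycle-visits-x (step _ (inj₁ ab) r)   tail-a v = walk-tail→cycle-visits-x r tail-b v
  walk-tail→cycle-visits-x (step _ (inj₂ xa) r)   tail-a _ = walk-head r
  walk-tail→cycle-visits-x (step _ (inj₂ ab) r)   tail-b v = walk-tail→cycle-visits-x r tail-a v

  transversal : (Fin k → Fin 3) → List (FV k)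
  transversal g = tabulate (λ i → c i (g i))

  transversal-unique : ∀ g → Unique (transversal g)
  transversal-unique g = Unique.tabulate⁺ λ { refl → refl }

  length-transversal : ∀ g → length (transversal g) ≡ k
  length-transversal g = length-tabulate _

  transversal-onCycle : ∀ {g u} → u ∈ transversal g → OnCycle u
  transversal-onCycle m with ∈-tabulate⁻ m
  ... | i , refl = on-cycle i _

  tail-dominator : ∀ {S} → Dominating (F k) S → ∃ λ y → y ∈ S × OnTail y
  tail-dominator D with D b
  ... | inj₁ b∈S                  = b , b∈S , tail-b
  ... | inj₂ (_ , a∈S , inj₁ ab)  = a , a∈S , tail-a

  cycle-dominator : ∀ {S} → Dominating (F k) S → (i : Fin k) → ∃ λ n → c i n ∈ S
  cycle-dominator D i with D (c i (suc zero))
  ... | inj₁ c₁∈S                      = suc zero , c₁∈S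
  ... | inj₂ (_ , c₀∈S , inj₁ (c01 i)) = zero , c₀∈S
  ... | inj₂ (_ , c₂∈S , inj₂ (c12 i)) = suc (suc zero) , c₂∈S

  transversal⊆dominating : ∀ {S} (D : Dominating (F k) S) →
                           transversal (λ i → proj₁ (cycle-dominator D i)) ⊆ S
  transversal⊆dominating D m with ∈-tabulate⁻ m
  ... | i , refl = proj₂ (cycle-dominator D i)

  dominating-size≥ : ∀ S → Unique S → Dominating (F k) S → suc k ≤ length S
  dominating-size≥ S _ D with tail-dominator D
  ... | y , y∈S , tail-y =
    subst (λ n → suc n ≤ length S) (length-transversal _)
      (Unique-⊆⇒length≤ {T = y ∷ T}
        (All.tabulate (λ m → tail≢cycle tail-y (transversal-onCycle m)) ∷ transversal-unique _)
        λ { (here refl) → y∈S ; (there m) → transversal⊆dominating D m })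
    where T = transversal (λ i → proj₁ (cycle-dominator D i))

  connDominating-size≥ : 1 ≤ k → ∀ S → Unique S → ConnDominating (F k) S → suc (suc k) ≤ length S
  connDominating-size≥ 1≤k S _ (D , C) with tail-dominator D
  ... | y , y∈S , tail-y =
    subst (λ n → suc (suc n) ≤ length S) (length-transversal _)
      (Unique-⊆⇒length≤ {T = x ∷ y ∷ T}
        (All.tabulate (λ { (here refl) → x≢tail tail-y ; (there m) → x≢cycle (transversal-onCycle m) })
          ∷ All.tabulate (λ m → tail≢cycle tail-y (transversal-onCycle m))
          ∷ transversal-unique _)
        λ { (here refl) → x∈S ; (there (here refl)) → y∈S ; (there (there m)) → transversal⊆dominating D m })
    where
      T = transversal (λ i → proj₁ (cycle-dominator D i))
      i₀ = fromℕ< 1≤k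
      x∈S : x ∈ S
      x∈S = walk-tail→cycle-visits-x (C y∈S (proj₂ (cycle-dominator D i₀))) tail-y (on-cycle i₀ _)

  minimumDominating : List (FV k)
  minimumDominating = a ∷ transversal (λ _ → suc zero)

  minimumDominating-dominating : Dominating (F k) minimumDominating
  minimumDominating-dominating x                      = inj₂ (a , here refl , inj₂ xa)
  minimumDominating-dominating a                      = inj₁ (here refl)
  minimumDominating-dominating b                      = inj₂ (a , here refl , inj₁ ab)
  minimumDominating-dominating (c i zero)             = inj₂ (_ , there (∈-tabulate⁺ i) , inj₂ (c01 i))
  minimumDominating-dominating (c i (suc zero))       = inj₁ (there (∈-tabulate⁺ i))
  minimumDominating-dominating (c i (suc (suc zero))) = inj₂ (_ , there (∈-tabulate⁺ i) , inj₁ (c12 i))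

  minimumDominating-unique : Unique minimumDominating
  minimumDominating-unique =
    All.tabulate (λ m → tail≢cycle tail-a (transversal-onCycle m)) ∷ transversal-unique _

  minimumConnDominating : List (FV k)
  minimumConnDominating = x ∷ a ∷ transversal (λ _ → zero)

  minimumConnDominating-dominating : Dominating (F k) minimumConnDominating
  minimumConnDominating-dominating x                      = inj₁ (here refl)
  minimumConnDominating-dominating a                      = inj₁ (there (here refl))
  minimumConnDominating-dominating b                      = inj₂ (a , there (here refl) , inj₁ ab)
  minimumConnDominating-dominating (c i zero)             = inj₁ (there (there (∈-tabulate⁺ i)))
  minimumConnDominating-dominating (c i (suc zero))       = inj₂ (_ , there (there (∈-tabulate⁺ i)) , inj₁ (c01 i))
  minimumConnDominating-dominating (c i (suc (suc zero))) = inj₂ (x , here refl , inj₂ (c2x i))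

  minimumConnDominating-connected : InducesConnected (F k) minimumConnDominating
  minimumConnDominating-connected = walk-via to-x
    where
      to-x : ∀ {u} → u ∈ minimumConnDominating → WalkIn (F k) (_∈ minimumConnDominating) u x
      to-x (here refl)         = here (here refl)
      to-x (there (here refl)) = step (there (here refl)) (inj₂ xa) (here (here refl))
      to-x (there (there m)) with ∈-tabulate⁻ m
      ... | i , refl           = step (there (there m)) (inj₂ (xc0 i)) (here (here refl))

  minimumConnDominating-unique : Unique minimumConnDominating
  minimumConnDominating-unique =
    All.tabulate (λ { (here refl) → x≢tail tail-a ; (there m) → x≢cycle (transversal-onCycle m) })
    ∷ All.tabulate (λ m → tail≢cycle tail-a (transversal-onCycle m))
    ∷ transversal-unique _

mainTheorem4 : (k : ℕ) → 1 ≤ k →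
    Connected (F k) × PFree 6 (F k) × CFree 6 (F k)
    × Σ ℕ (λ m → IsDomNumber (F k) m × IsConnDomNumber (F k) (suc m))
mainTheorem4 k 1≤k =
  F-connected ,
  inner-of-every-P₄⇒P₆-free x-inner-of-every-P₄ ,
  inner-of-every-P₄⇒C₆-free x-inner-of-every-P₄ ,
  suc k ,
  ( ( minimumDominating , minimumDominating-unique , minimumDominating-dominating
    , cong suc (length-transversal _))
  , dominating-size≥ ) ,
  ( ( minimumConnDominating , minimumConnDominating-unique
    , (minimumConnDominating-dominating , minimumConnDominating-connected)
    , cong (λ n → suc (suc n)) (length-transversal _))
  , connDominating-size≥ 1≤k )
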